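{- Let $k$ and $r$ be positive integers with $1 \le r \le k-2$, and let $F$ be a finite field. Define $f$ on $k$-element subsets $A$ of $F$ by $f(A) = (e_1(A), e_2(A), \ldots, e_r(A)) \in F^r$. If $A$ and $B$ are subsets of $F$ with $|A| = |B| = k$ and $k - r \leq |A \cap B| \leq k-1$, then $f(A) \neq f(B)$.
   Context: For a finite subset $Z = \{z_1,\ldots,z_n\}$ of a field $F$ and an integer $i \ge 0$, $e_i(Z) = \sum_{1 \le t_1 < \cdots < t_i \le n} z_{t_1}\cdots z_{t_i}$ (the $i$-th elementary symmetric polynomial of the elements of $Z$), with $e_0(Z)=1_F$ and $e_i(Z)=0_F$ if $i>|Z|$. -}

module Defs where

open import Level using (Level; _⊔_)
open import Algebra.Bundles using (CommutativeRing)
open import Data.Nat using (ℕ; zero; suc)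
open import Data.Fin using (Fin)
open import Data.Fin.Subset using (Subset; Side; inside; outside)
open import Data.Vec using (Vec; []; _∷_)
open import Data.List using (List; []; _∷_; map)
open import Data.Product using (Σ; ∃)
open import Relation.Binary.PropositionalEquality using (_≡_)
open import Relation.Nullary using (¬_)

record FiniteField (c ℓ : Level) : Set (Level.suc (c ⊔ ℓ)) where
  field
    commRing : CommutativeRing c ℓ
  open CommutativeRing commRing public
  field
    1≉0      : ¬ (1# ≈ 0#)
    inverse  : ∀ x → ¬ (x ≈ 0#) → Σ Carrier (λ y → (x * y) ≈ 1#)
    size     : ℕ
    enum     : Fin size → Carrier
    enum-inj : ∀ i j → enum i ≈ enum j → i ≡ j
    enum-sur : ∀ x → Σ (Fin size) (λ i → enum i ≈ x)

module _ {c ℓ : Level} (F : FiniteField c ℓ) where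
  open FiniteField F

  esym : List Carrier → ℕ → Carrier
  esym []       zero    = 1#
  esym []       (suc i) = 0#
  esym (x ∷ xs) zero    = 1#
  esym (x ∷ xs) (suc i) = esym xs (suc i) + x * esym xs i

  members : ∀ {n} → Subset n → List (Fin n)
  members []             = []
  members (outside ∷ s)  = map Fin.suc (members s)
  members (inside ∷ s)   = Fin.zero ∷ map Fin.suc (members s)

  -- a subset of F is a subset of the index set Fin size, via enum
  elems : Subset size → List Carrier
  elems Z = map enum (members Z)

  e : ℕ → Subset size → Carrier
  e i Z = esym (elems Z) i

-- Cancelling the common part A ∩ B (the generating polynomial ∏ (1 + x t) is multiplicative
-- with constant term 1) leaves the two differences A ∖ B and B ∖ A, of the same size m with
-- 1 ≤ m ≤ r, sharing e_1, …, e_m. Then ∏_{a ∈ A∖B} (z + a) = ∏_{b ∈ B∖A} (z + b) as polynomials, and at z = −a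
-- for some a ∈ A ∖ B the left side vanishes while the right side, a product of nonzero
-- field elements, does not.
module Submission where

open import Defs
open import Level using (Level)
open import Algebra.Bundles using (CommutativeRing)
import Algebra.Properties.Group as GroupProperties
open import Data.Nat using (ℕ; zero; suc; _≤_; _<_; _∸_; s≤s; z≤n)
import Data.Nat as ℕ
open import Data.Nat.Properties
  using (≤-trans; ≤-refl; ≤-reflexive; n≤1+n; m<n⇒m<1+n; m∸n≤m; ∸-monoʳ-≤; m∸[m∸n]≡n; m+n∸m≡n)
import Data.Fin as Fin
open import Data.Fin.Subset using (Subset; ∣_∣; _∩_; ∁; inside; outside) renaming (_∈_ to _∈ˢ_)
open import Data.Fin.Subset.Properties using (∩-comm; x∈p∩q⁻; x∈∁p⇒x∉p)
open import Data.Vec.Base using ([]; _∷_; here; there)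
open import Data.List using (List; []; _∷_; _++_; length; map)
open import Data.List.Properties using (map-++; length-map; length-++)
open import Data.List.Membership.Propositional using (_∈_)
open import Data.List.Membership.Propositional.Properties using (∈-map⁻)
open import Data.List.Relation.Unary.Any using (here; there)
open import Data.List.Relation.Unary.All as All using (All; []; _∷_)
open import Data.List.Relation.Binary.Permutation.Propositional as ↭ using (_↭_; prep)
open import Data.List.Relation.Binary.Permutation.Propositional.Properties using (↭-length; shift; map⁺)
open import Data.Maybe using (nothing)
open import Data.Product using (_,_; proj₁; proj₂)
open import Function using (_∘_)
open import Relation.Nullary using (¬_; contradiction)
open import Relation.Binary.PropositionalEquality as ≡ using (_≡_)
import Relation.Binary.Reasoning.Setoid as SetoidReasoning
open import Tactic.RingSolver using (solve-∀)
open import Tactic.RingSolver.Core.AlmostCommutativeRing using (AlmostCommutativeRing; fromCommutativeRing)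

private
  module RingIdentities {c ℓ : Level} (R : CommutativeRing c ℓ) where
    solverRing : AlmostCommutativeRing c ℓ
    -- the solver's zero test is only an optimisation, so the trivial one suffices
    solverRing = fromCommutativeRing R (λ _ → nothing)
    open AlmostCommutativeRing solverRing

    exchange₀ : ∀ x y w → (w + y * 1#) + x * 1# ≈ (w + x * 1#) + y * 1#
    exchange₀ = solve-∀ solverRing

    exchange : ∀ x y u v w → (w + y * v) + x * (v + y * u) ≈ (w + x * v) + y * (v + x * u)
    exchange = solve-∀ solverRing

    horner-step₀ : ∀ z y w → z * 1# + (w + y * 1#) ≈ (z * 1# + w) + y * 1#
    horner-step₀ = solve-∀ solverRing

    horner-step : ∀ z y h h′ v w → z * (h + y * h′) + (w + y * v) ≈ (z * h + w) + y * (z * h′ + v)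
    horner-step = solve-∀ solverRing

m∸n≤o⇒m∸o≤n : ∀ {m n o} → n ≤ m → m ∸ n ≤ o → m ∸ o ≤ n
m∸n≤o⇒m∸o≤n {m} n≤m m∸n≤o = ≤-trans (∸-monoʳ-≤ m m∸n≤o) (≤-reflexive (m∸[m∸n]≡n n≤m))

o≤m∸n⇒n≤m∸o : ∀ {m n o} → n ≤ m → o ≤ m ∸ n → n ≤ m ∸ o
o≤m∸n⇒n≤m∸o {m} n≤m o≤m∸n = ≤-trans (≤-reflexive (≡.sym (m∸[m∸n]≡n n≤m))) (∸-monoʳ-≤ m o≤m∸n)

map⁺-++ : ∀ {a b} {A : Set a} {B : Set b} (f : A → B) {xs} ys {zs : List A} →
          xs ↭ ys ++ zs → map f xs ↭ map f ys ++ map f zs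
map⁺-++ f ys p = ↭.trans (map⁺ f p) (↭.↭-reflexive (map-++ f ys _))

module _ {c ℓ : Level} (F : FiniteField c ℓ) where
  open FiniteField F
  open RingIdentities commRing
  open GroupProperties +-group using (∙-cancelʳ; inverseˡ-unique; ⁻¹-injective)
  open SetoidReasoning setoid

  esym-zero : ∀ xs → esym F xs 0 ≡ 1#
  esym-zero []      = ≡.refl
  esym-zero (_ ∷ _) = ≡.refl

  esym-cong-∷ : ∀ x {xs ys} → (∀ i → esym F xs i ≈ esym F ys i) →
                ∀ i → esym F (x ∷ xs) i ≈ esym F (x ∷ ys) i
  esym-cong-∷ x eq zero    = refl
  esym-cong-∷ x eq (suc i) = +-cong (eq (suc i)) (*-cong refl (eq i))

  esym-swap : ∀ x y xs i → esym F (x ∷ y ∷ xs) i ≈ esym F (y ∷ x ∷ xs) i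
  esym-swap x y xs zero          = refl
  esym-swap x y xs (suc zero)    rewrite esym-zero xs = exchange₀ x y (esym F xs 1)
  esym-swap x y xs (suc (suc i)) =
    exchange x y (esym F xs i) (esym F xs (suc i)) (esym F xs (suc (suc i)))

  esym-↭ : ∀ {xs ys} → xs ↭ ys → ∀ i → esym F xs i ≈ esym F ys i
  esym-↭ ↭.refl          i = refl
  esym-↭ (↭.prep x p)    i = esym-cong-∷ x (esym-↭ p) i
  esym-↭ (↭.swap x y p)  i = trans (esym-swap x y _ i) (esym-cong-∷ y (esym-cong-∷ x (esym-↭ p)) i)
  esym-↭ (↭.trans p q)   i = trans (esym-↭ p i) (esym-↭ q i)

  esym-beyond-length : ∀ xs {i} → length xs < i → esym F xs i ≈ 0#
  esym-beyond-length []       {suc i} _         = refl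
  esym-beyond-length (x ∷ xs) {suc i} (s≤s lt) = begin
    esym F xs (suc i) + x * esym F xs i ≈⟨ +-cong (esym-beyond-length xs (m<n⇒m<1+n lt))
                                                  (*-cong refl (esym-beyond-length xs lt)) ⟩
    0# + x * 0#                         ≈⟨ trans (+-identityˡ _) (zeroʳ x) ⟩
    0#                                  ∎

  EsymAgree : ℕ → List Carrier → List Carrier → Set ℓ
  EsymAgree r xs ys = ∀ i → i ≤ r → esym F xs i ≈ esym F ys i

  EsymAgree-∷-cancel : ∀ {r} x {xs ys} → EsymAgree r (x ∷ xs) (x ∷ ys) → EsymAgree r xs ys
  EsymAgree-∷-cancel x {xs} {ys} agree zero    _   rewrite esym-zero xs | esym-zero ys = refl
  EsymAgree-∷-cancel x {xs} {ys} agree (suc i) i<r = ∙-cancelʳ (x * esym F xs i) _ _ (begin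
    esym F xs (suc i) + x * esym F xs i ≈⟨ agree (suc i) i<r ⟩
    esym F ys (suc i) + x * esym F ys i ≈⟨ +-cong refl (*-cong refl (sym previous)) ⟩
    esym F ys (suc i) + x * esym F xs i ∎)
    where previous = EsymAgree-∷-cancel x agree i (≤-trans (n≤1+n i) i<r)

  EsymAgree-++-cancel : ∀ {r} zs {xs ys} → EsymAgree r (zs ++ xs) (zs ++ ys) → EsymAgree r xs ys
  EsymAgree-++-cancel []       agree = agree
  EsymAgree-++-cancel (z ∷ zs) agree = EsymAgree-++-cancel zs (EsymAgree-∷-cancel z agree)

  EsymAgree-↭ : ∀ {r xs xs′ ys ys′} → xs ↭ xs′ → ys ↭ ys′ → EsymAgree r xs ys → EsymAgree r xs′ ys′
  EsymAgree-↭ p q agree i i≤r = trans (sym (esym-↭ p i)) (trans (agree i i≤r) (esym-↭ q i))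

  -- horner xs z n = Σ_{i ≤ n} z^(n − i) e_i(xs)
  horner : List Carrier → Carrier → ℕ → Carrier
  horner xs z zero    = 1#
  horner xs z (suc n) = z * horner xs z n + esym F xs (suc n)

  horner-cong : ∀ {r xs ys} z {n} → n ≤ r → EsymAgree r xs ys → horner xs z n ≈ horner ys z n
  horner-cong z {zero}  _   _     = refl
  horner-cong z {suc n} n≤r agree =
    +-cong (*-cong refl (horner-cong z (≤-trans (n≤1+n n) n≤r) agree)) (agree (suc n) n≤r)

  horner-∷ : ∀ y xs z n → horner (y ∷ xs) z (suc n) ≈ horner xs z (suc n) + y * horner xs z n
  horner-∷ y xs z zero    rewrite esym-zero xs = horner-step₀ z y (esym F xs 1)
  horner-∷ y xs z (suc n) = begin
    z * horner (y ∷ xs) z (suc n) + esym F (y ∷ xs) (suc (suc n))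
      ≈⟨ +-cong (*-cong refl (horner-∷ y xs z n)) refl ⟩
    z * (horner xs z (suc n) + y * horner xs z n) + (esym F xs (suc (suc n)) + y * esym F xs (suc n))
      ≈⟨ horner-step z y (horner xs z (suc n)) (horner xs z n) (esym F xs (suc n)) (esym F xs (suc (suc n))) ⟩
    (z * horner xs z (suc n) + esym F xs (suc (suc n))) + y * (z * horner xs z n + esym F xs (suc n))
      ∎

  linearFactors : Carrier → List Carrier → Carrier
  linearFactors z []       = 1#
  linearFactors z (x ∷ xs) = (z + x) * linearFactors z xs

  horner-length≈linearFactors : ∀ xs z → horner xs z (length xs) ≈ linearFactors z xs
  horner-length≈linearFactors []       z = refl
  horner-length≈linearFactors (x ∷ xs) z = begin
    horner (x ∷ xs) z (suc (length xs))
      ≈⟨ horner-∷ x xs z (length xs) ⟩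
    (z * horner xs z (length xs) + esym F xs (suc (length xs))) + x * horner xs z (length xs)
      ≈⟨ +-cong (+-cong refl (esym-beyond-length xs ≤-refl)) refl ⟩
    (z * horner xs z (length xs) + 0#) + x * horner xs z (length xs)
      ≈⟨ trans (+-cong (+-identityʳ _) refl) (sym (distribʳ _ z x)) ⟩
    (z + x) * horner xs z (length xs)
      ≈⟨ *-cong refl (horner-length≈linearFactors xs z) ⟩
    (z + x) * linearFactors z xs
      ∎

  linearFactors-root : ∀ {a xs} → a ∈ xs → linearFactors (- a) xs ≈ 0#
  linearFactors-root {a} (here ≡.refl) = trans (*-cong (-‿inverseˡ a) refl) (zeroˡ _)
  linearFactors-root (there a∈xs)      = trans (*-cong refl (linearFactors-root a∈xs)) (zeroʳ _)

  *-nonzero : ∀ {x y} → ¬ x ≈ 0# → ¬ y ≈ 0# → ¬ x * y ≈ 0#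
  *-nonzero {x} {y} x≉0 y≉0 xy≈0 with inverse x x≉0
  ... | x⁻¹ , xx⁻¹≈1 = y≉0 (begin
    y              ≈⟨ sym (*-identityˡ y) ⟩
    1# * y         ≈⟨ *-cong (sym xx⁻¹≈1) refl ⟩
    (x * x⁻¹) * y  ≈⟨ trans (*-cong (*-comm x x⁻¹) refl) (*-assoc x⁻¹ x y) ⟩
    x⁻¹ * (x * y)  ≈⟨ *-cong refl xy≈0 ⟩
    x⁻¹ * 0#       ≈⟨ zeroʳ x⁻¹ ⟩
    0#             ∎)

  linearFactors-nonzero : ∀ {a ys} → All (λ y → ¬ a ≈ y) ys → ¬ linearFactors (- a) ys ≈ 0#
  linearFactors-nonzero []                 = 1≉0
  linearFactors-nonzero {a} (a≉y ∷ a≉ys) =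
    *-nonzero (λ -a+y≈0 → a≉y (⁻¹-injective (inverseˡ-unique (- a) _ -a+y≈0))) (linearFactors-nonzero a≉ys)

  esym-agree-disjoint⇒[] : ∀ {xs ys} → length xs ≡ length ys → EsymAgree (length xs) xs ys →
                           (∀ {x y} → x ∈ xs → y ∈ ys → ¬ x ≈ y) → xs ≡ []
  esym-agree-disjoint⇒[] {[]}     _  _     _        = ≡.refl
  esym-agree-disjoint⇒[] {a ∷ xs} {ys} len agree disjoint =
    contradiction ys-vanish (linearFactors-nonzero (All.tabulate (disjoint (here ≡.refl))))
    where
    ys-vanish : linearFactors (- a) ys ≈ 0#
    ys-vanish = begin
      linearFactors (- a) ys                  ≈⟨ sym (horner-length≈linearFactors ys (- a)) ⟩
      horner ys (- a) (length ys)             ≈⟨ reflexive (≡.cong (horner ys (- a)) (≡.sym len)) ⟩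
      horner ys (- a) (length (a ∷ xs))       ≈⟨ sym (horner-cong (- a) ≤-refl agree) ⟩
      horner (a ∷ xs) (- a) (length (a ∷ xs)) ≈⟨ horner-length≈linearFactors (a ∷ xs) (- a) ⟩
      linearFactors (- a) (a ∷ xs)            ≈⟨ linearFactors-root {xs = a ∷ xs} (here ≡.refl) ⟩
      0#                                      ∎

module _ {c ℓ : Level} (F : FiniteField c ℓ) where
  open FiniteField F using (_≈_; size; enum; enum-inj)
  open ≡.≡-Reasoning

  length-members : ∀ {n} (p : Subset n) → length (members F p) ≡ ∣ p ∣
  length-members []            = ≡.refl
  length-members (outside ∷ p) = ≡.trans (length-map Fin.suc (members F p)) (length-members p)
  length-members (inside ∷ p)  = ≡.cong suc (≡.trans (length-map Fin.suc (members F p)) (length-members p))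

  ∈-members⇒∈ : ∀ {n} {p : Subset n} {i} → i ∈ members F p → i ∈ˢ p
  ∈-members⇒∈ {p = inside ∷ p}  (here ≡.refl) = here
  ∈-members⇒∈ {p = inside ∷ p}  (there i∈p)   with ∈-map⁻ Fin.suc i∈p
  ... | j , j∈p , ≡.refl = there (∈-members⇒∈ j∈p)
  ∈-members⇒∈ {p = outside ∷ p} i∈p           with ∈-map⁻ Fin.suc i∈p
  ... | j , j∈p , ≡.refl = there (∈-members⇒∈ j∈p)

  members-∩-∁ : ∀ {n} (p q : Subset n) → members F p ↭ members F (p ∩ q) ++ members F (p ∩ ∁ q)
  members-∩-∁ []            []            = ↭.refl
  members-∩-∁ (outside ∷ p) (_ ∷ q)       = map⁺-++ Fin.suc (members F (p ∩ q)) (members-∩-∁ p q)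
  members-∩-∁ (inside ∷ p)  (inside ∷ q)  =
    prep Fin.zero (map⁺-++ Fin.suc (members F (p ∩ q)) (members-∩-∁ p q))
  members-∩-∁ (inside ∷ p)  (outside ∷ q) = ↭.trans
    (prep Fin.zero (map⁺-++ Fin.suc (members F (p ∩ q)) (members-∩-∁ p q)))
    (↭.↭-sym (shift Fin.zero (map Fin.suc (members F (p ∩ q))) (map Fin.suc (members F (p ∩ ∁ q)))))

  elems-∩-∁ : ∀ (p q : Subset size) → elems F p ↭ elems F (p ∩ q) ++ elems F (p ∩ ∁ q)
  elems-∩-∁ p q = map⁺-++ enum (members F (p ∩ q)) (members-∩-∁ p q)

  length-elems : ∀ (p : Subset size) → length (elems F p) ≡ ∣ p ∣
  length-elems p = ≡.trans (length-map enum (members F p)) (length-members p)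

  length-elems-∩-∁ : ∀ (p q : Subset size) → length (elems F (p ∩ ∁ q)) ≡ ∣ p ∣ ∸ ∣ p ∩ q ∣
  length-elems-∩-∁ p q = ≡.trans (≡.sym (m+n∸m≡n ∣ p ∩ q ∣ d)) (≡.cong (_∸ ∣ p ∩ q ∣) split)
    where
    d = length (elems F (p ∩ ∁ q))
    split : ∣ p ∩ q ∣ ℕ.+ d ≡ ∣ p ∣
    split = begin
      ∣ p ∩ q ∣ ℕ.+ d                                ≡⟨ ≡.cong (ℕ._+ d) (≡.sym (length-elems (p ∩ q))) ⟩
      length (elems F (p ∩ q)) ℕ.+ d                 ≡⟨ ≡.sym (length-++ (elems F (p ∩ q))) ⟩
      length (elems F (p ∩ q) ++ elems F (p ∩ ∁ q))  ≡⟨ ≡.sym (↭-length (elems-∩-∁ p q)) ⟩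
      length (elems F p)                             ≡⟨ length-elems p ⟩
      ∣ p ∣                                          ∎

  elems-∩-∁-disjoint : ∀ (p q : Subset size) {x y} →
                       x ∈ elems F (p ∩ ∁ q) → y ∈ elems F (q ∩ ∁ p) → ¬ x ≈ y
  elems-∩-∁-disjoint p q x∈ y∈ x≈y with ∈-map⁻ enum x∈ | ∈-map⁻ enum y∈
  ... | i , i∈ , ≡.refl | j , j∈ , ≡.refl with enum-inj i j x≈y
  ... | ≡.refl =
    x∈∁p⇒x∉p (proj₂ (x∈p∩q⁻ q (∁ p) (∈-members⇒∈ j∈))) (proj₁ (x∈p∩q⁻ p (∁ q) (∈-members⇒∈ i∈)))

  EsymAgree-∩-∁ : ∀ {r} (p q : Subset size) → EsymAgree F r (elems F p) (elems F q) →
                  EsymAgree F r (elems F (p ∩ ∁ q)) (elems F (q ∩ ∁ p))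
  EsymAgree-∩-∁ p q = EsymAgree-++-cancel F (elems F (p ∩ q)) ∘ EsymAgree-↭ F (elems-∩-∁ p q)
    (≡.subst (λ s → elems F q ↭ elems F s ++ elems F (q ∩ ∁ p)) (∩-comm q p) (elems-∩-∁ q p))

lemma2p2 : ∀ {c ℓ : Level} (F : FiniteField c ℓ) (k r : ℕ) →
    1 ≤ r → r ≤ k ∸ 2 →
    (A B : Subset (FiniteField.size F)) →
    ∣ A ∣ ≡ k → ∣ B ∣ ≡ k →
    k ∸ r ≤ ∣ A ∩ B ∣ → ∣ A ∩ B ∣ ≤ k ∸ 1 →
    ¬ (∀ (i : ℕ) → 1 ≤ i → i ≤ r →
    FiniteField._≈_ F (e F i A) (e F i B))
lemma2p2 F k r 1≤r r≤k∸2 A B ∣A∣≡k ∣B∣≡k k∸r≤∣A∩B∣ ∣A∩B∣≤k∸1 same-e =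
  contradiction (≡.subst (1 ≤_) (≡.cong length A∖B-empty) 1≤∣A∖B∣) λ ()
  where
  open FiniteField F using (refl)
  A∖B = elems F (A ∩ ∁ B)
  B∖A = elems F (B ∩ ∁ A)

  r≤k : r ≤ k
  r≤k = ≤-trans r≤k∸2 (m∸n≤m k 2)

  ∣A∖B∣≡k∸∣A∩B∣ : length A∖B ≡ k ∸ ∣ A ∩ B ∣
  ∣A∖B∣≡k∸∣A∩B∣ = ≡.trans (length-elems-∩-∁ F A B) (≡.cong (_∸ ∣ A ∩ B ∣) ∣A∣≡k)

  ∣B∖A∣≡k∸∣A∩B∣ : length B∖A ≡ k ∸ ∣ A ∩ B ∣
  ∣B∖A∣≡k∸∣A∩B∣ = ≡.trans (length-elems-∩-∁ F B A) (≡.cong₂ _∸_ ∣B∣≡k (≡.cong ∣_∣ (∩-comm B A)))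

  1≤∣A∖B∣ : 1 ≤ length A∖B
  1≤∣A∖B∣ = ≤-trans (o≤m∸n⇒n≤m∸o (≤-trans 1≤r r≤k) ∣A∩B∣≤k∸1) (≤-reflexive (≡.sym ∣A∖B∣≡k∸∣A∩B∣))

  ∣A∖B∣≤r : length A∖B ≤ r
  ∣A∖B∣≤r = ≤-trans (≤-reflexive ∣A∖B∣≡k∸∣A∩B∣) (m∸n≤o⇒m∸o≤n r≤k k∸r≤∣A∩B∣)

  agree : EsymAgree F r (elems F A) (elems F B)
  agree zero    _   rewrite esym-zero F (elems F A) | esym-zero F (elems F B) = refl
  agree (suc i) i<r = same-e (suc i) (s≤s z≤n) i<r

  A∖B-empty : A∖B ≡ []
  A∖B-empty = esym-agree-disjoint⇒[] F (≡.trans ∣A∖B∣≡k∸∣A∩B∣ (≡.sym ∣B∖A∣≡k∸∣A∩B∣))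
    (λ i i≤∣A∖B∣ → EsymAgree-∩-∁ F A B agree i (≤-trans i≤∣A∖B∣ ∣A∖B∣≤r)) (elems-∩-∁-disjoint F A B)
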